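{- Let $n\ge 3$ and let $P_n=x_1x_2\dots x_n$ be the path of order $n$. Let $f$ be a maximal independent broadcast on $P_n$ of minimum cost $i_b(P_n)$, with $V^+_f=\{x_{i_1},\dots,x_{i_t}\}$, $i_1<\dots<i_t$, $t\ge2$. Then: (1) $f(x_{i_1})\ge f(x_{i_2})$ and $f(x_{i_t})\ge f(x_{i_{t-1}})$; (2) $d_{P_n}(x_1,x_{i_1})\le f(x_{i_1})$ and $d_{P_n}(x_{i_t},x_n)\le f(x_{i_t})$; (3) for every $j$, $1\le j\le t-1$, $\max\{f(x_{i_j}),f(x_{i_{j+1}})\}+1\le d_{P_n}(x_{i_j},x_{i_{j+1}})\le f(x_{i_j})+f(x_{i_{j+1}})+1$; (4) $d_{P_n}(x_{i_1},x_{i_2})=f(x_{i_1})+1$ and $d_{P_n}(x_{i_{t-1}},x_{i_t})=f(x_{i_t})+1$.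
   Context: For a graph $G=(V,E)$, a broadcast is a function $f:V\to\{0,\dots,\operatorname{diam}(G)\}$ with $f(v)\le e_G(v)$ (eccentricity) for all $v$. Let $V^+_f=\{v: f(v)>0\}$ and $H_f(u)=\{v\in V^+_f: d_G(u,v)\le f(v)\}$. The cost is $\sigma(f)=\sum_v f(v)$. $f$ is independent if $|H_f(v)|=1$ for every $v\in V^+_f$. An independent broadcast $f$ is maximal if no independent broadcast $g\ne f$ satisfies $g\ge f$ pointwise. $i_b(G)$ is the minimum cost of a maximal independent broadcast on $G$. -}

module Defs where

open import Data.Nat using (ℕ; zero; suc; _≤_; _<_; _≤?_; _<?_; _∸_; _⊔_; ∣_-_∣)
open import Data.Fin using (Fin; toℕ)
open import Data.Fin.Subset using (Subset; ∣_∣)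
open import Data.Vec using (tabulate)
open import Data.List using (map; allFin)
open import Data.Nat.ListAction using (sum)
open import Data.Bool using (_∧_)
open import Data.Product using (Σ; _×_)
open import Relation.Nullary using (does)
open import Relation.Binary.PropositionalEquality using (_≡_)

-- The path P_n : vertex x_{i+1} is represented by (i : Fin n); edges join i and i+1.

dist : ∀ {n} → Fin n → Fin n → ℕ
dist u v = ∣ toℕ u - toℕ v ∣

ecc : ∀ {n} → Fin n → ℕ
ecc {n} v = toℕ v ⊔ (n ∸ 1 ∸ toℕ v)

diam : ℕ → ℕ
diam n = n ∸ 1

IsBroadcast : ∀ {n} → (Fin n → ℕ) → Set
IsBroadcast {n} f = ∀ v → (f v ≤ diam n) × (f v ≤ ecc v)

H : ∀ {n} → (Fin n → ℕ) → Fin n → Subset n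
H f u = tabulate (λ v → does (0 <? f v) ∧ does (dist u v ≤? f v))

cost : ∀ {n} → (Fin n → ℕ) → ℕ
cost {n} f = sum (map f (allFin n))

IsIndependent : ∀ {n} → (Fin n → ℕ) → Set
IsIndependent {n} f = IsBroadcast f × (∀ v → 0 < f v → ∣ H f v ∣ ≡ 1)

IsMaximalIndependent : ∀ {n} → (Fin n → ℕ) → Set
IsMaximalIndependent {n} f =
  IsIndependent f ×
  (∀ (g : Fin n → ℕ) → IsIndependent g → (∀ v → f v ≤ g v) → ∀ v → g v ≡ f v)

IsMinMaximalIndependent : ∀ {n} → (Fin n → ℕ) → Set
IsMinMaximalIndependent {n} f =
  IsMaximalIndependent f ×
  (∀ (g : Fin n → ℕ) → IsMaximalIndependent g → cost f ≤ cost g)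

-- A vertex that
-- no broadcasting vertex reaches could broadcast with power 1, and a broadcasting
-- vertex all of whose fellow broadcasters lie more than f + 1 away could raise its
-- power by 1. On a path a broadcasting vertex hides everything behind it from
-- the other side, so only consecutive broadcasting vertices x, y matter: a gap
-- longer than f(x) + f(y) + 1 leaves the vertex at distance f(x) + 1 from x
-- unreached, an end of the path beyond the reach of the outermost broadcaster is
-- unreached, and an outermost broadcaster can be raised unless its neighbour is
-- at distance exactly f + 1. Independence of that neighbour then gives (1).
module Submission where

open import Defs
open import Data.Nat using (ℕ; suc; z≤n; s≤s; _≤_; _<_; _≥_; _+_; _∸_; _⊔_; ∣_-_∣; _≤?_; _<?_)
open import Data.Nat.Properties hiding (_≟_)
open import Data.Nat.Solver using (module +-*-Solver)
open import Data.Fin using (Fin; toℕ; zero; suc; fromℕ; fromℕ<; inject₁; _≟_) renaming (_<_ to _<ᶠ_)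
open import Data.Fin.Properties using (toℕ-injective; toℕ-inject₁; toℕ-fromℕ; toℕ-fromℕ<; toℕ≤pred[n]; toℕ<n; ≤̄⇒inject₁<)
open import Data.Fin.Subset using (∣_∣; _∈_; _⊆_; _⊂_; ⁅_⁆)
open import Data.Fin.Subset.Properties using (x∈⁅x⁆; x∈⁅y⁆⇒x≡y; x≢y⇒x∉⁅y⁆; ∣⁅x⁆∣≡1; ⊆-antisym; p⊂q⇒∣p∣<∣q∣)
open import Data.Vec.Properties using (lookup∘tabulate; []=⇒lookup; lookup⇒[]=)
open import Data.Product using (_×_; ∃; _,_; proj₁; proj₂)
open import Data.Sum using (_⊎_; inj₁; inj₂)
open import Function.Bundles using (_⇔_; Equivalence)
open import Relation.Binary.PropositionalEquality using (_≡_; _≢_; refl; sym; trans; cong; subst; subst₂; ≢-sym)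
open import Relation.Binary.Definitions using (tri<; tri≈; tri>)
open import Relation.Nullary using (¬_; yes; no; proof; contradiction)
open import Relation.Nullary.Decidable using (_×-dec_; dec-true)
open import Relation.Nullary.Reflects using (Reflects; invert)

private variable
  n : ℕ

dist-sym : (u v : Fin n) → dist u v ≡ dist v u
dist-sym u v = ∣-∣-comm (toℕ u) (toℕ v)

dist-self : (u : Fin n) → dist u u ≡ 0
dist-self u = ∣n-n∣≡0 (toℕ u)

toℕ<⇒≢ : {u v : Fin n} → toℕ u < toℕ v → u ≢ v
toℕ<⇒≢ u<v u≡v = <⇒≢ u<v (cong toℕ u≡v)

dist≤ecc : (u v : Fin n) → dist u v ≤ ecc u
dist≤ecc {suc n} u v with ≤-total (toℕ u) (toℕ v)
... | inj₁ u≤v = begin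
  ∣ toℕ u - toℕ v ∣        ≡⟨ m≤n⇒∣m-n∣≡n∸m u≤v ⟩
  toℕ v ∸ toℕ u            ≤⟨ ∸-monoˡ-≤ (toℕ u) (toℕ≤pred[n] v) ⟩
  n ∸ toℕ u                ≤⟨ m≤n⊔m (toℕ u) (n ∸ toℕ u) ⟩
  ecc u                    ∎
  where open ≤-Reasoning
... | inj₂ v≤u = begin
  ∣ toℕ u - toℕ v ∣        ≡⟨ m≤n⇒∣n-m∣≡n∸m v≤u ⟩
  toℕ u ∸ toℕ v            ≤⟨ m∸n≤m (toℕ u) (toℕ v) ⟩
  toℕ u                    ≤⟨ m≤m⊔n (toℕ u) (n ∸ toℕ u) ⟩
  ecc u                    ∎
  where open ≤-Reasoning

ecc≤diam : (u : Fin n) → ecc u ≤ diam n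
ecc≤diam {suc n} u = ⊔-lub (toℕ≤pred[n] u) (m∸n≤m n (toℕ u))

1≤ecc : (u : Fin (2 + n)) → 1 ≤ ecc u
1≤ecc zero    = s≤s z≤n
1≤ecc {n} (suc u) = ≤-trans (s≤s z≤n) (m≤m⊔n (suc (toℕ u)) (n ∸ toℕ u))

Between : Fin n → Fin n → Fin n → Set
Between u v w = (toℕ u ≤ toℕ v × toℕ v ≤ toℕ w) ⊎ (toℕ w ≤ toℕ v × toℕ v ≤ toℕ u)

between⇒dist≤ : {u v w : Fin n} → Between u v w → dist u v ≤ dist u w
between⇒dist≤ {u = u} {v} {w} (inj₁ (u≤v , v≤w)) =
  subst₂ _≤_ (sym (m≤n⇒∣m-n∣≡n∸m u≤v)) (sym (m≤n⇒∣m-n∣≡n∸m (≤-trans u≤v v≤w)))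
    (∸-monoˡ-≤ (toℕ u) v≤w)
between⇒dist≤ {u = u} {v} {w} (inj₂ (w≤v , v≤u)) =
  subst₂ _≤_ (sym (m≤n⇒∣n-m∣≡n∸m v≤u)) (sym (m≤n⇒∣n-m∣≡n∸m (≤-trans w≤v v≤u)))
    (∸-monoʳ-≤ (toℕ u) w≤v)

∣m-n∣>a+b+1⇒m+[1+a]+[1+b]≤n : ∀ {m n} a b → m ≤ n → a + b + 1 < ∣ m - n ∣ → m + suc a + suc b ≤ n
∣m-n∣>a+b+1⇒m+[1+a]+[1+b]≤n {m} {n} a b m≤n wide = begin
  m + suc a + suc b      ≡⟨ solve 3 (λ m a b → m :+ (con 1 :+ a) :+ (con 1 :+ b)
                                             := m :+ (con 1 :+ (a :+ b :+ con 1))) refl m a b ⟩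
  m + suc (a + b + 1)    ≤⟨ +-monoʳ-≤ m wide ⟩
  m + ∣ m - n ∣          ≡⟨ cong (m +_) (m≤n⇒∣m-n∣≡n∸m m≤n) ⟩
  m + (n ∸ m)            ≡⟨ m+[n∸m]≡n m≤n ⟩
  n                      ∎
  where open ≤-Reasoning
        open +-*-Solver

m+n≤o⇒n≤∣o-m∣ : ∀ m {n o} → m + n ≤ o → n ≤ ∣ o - m ∣
m+n≤o⇒n≤∣o-m∣ m {n} {o} le =
  subst (n ≤_) (sym (m≤n⇒∣n-m∣≡n∸m (m+n≤o⇒m≤o m le)))
    (m+n≤o⇒m≤o∸n n (subst (_≤ o) (+-comm m n) le))

∈H⁺ : (f : Fin n → ℕ) (u : Fin n) {x : Fin n} → 0 < f x → dist u x ≤ f x → x ∈ H f u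
∈H⁺ f u {x} fx>0 u∼x = lookup⇒[]= x (H f u)
  (trans (lookup∘tabulate _ x) (dec-true (0 <? f x ×-dec dist u x ≤? f x) (fx>0 , u∼x)))

∈H⁻ : (f : Fin n → ℕ) (u : Fin n) {x : Fin n} → x ∈ H f u → 0 < f x × dist u x ≤ f x
∈H⁻ f u {x} x∈H = invert (subst (Reflects (0 < f x × dist u x ≤ f x))
  (trans (sym (lookup∘tabulate _ x)) ([]=⇒lookup x∈H)) (proof (0 <? f x ×-dec dist u x ≤? f x)))

⁅u⁆⊆H : {f : Fin n → ℕ} {u : Fin n} → 0 < f u → ⁅ u ⁆ ⊆ H f u
⁅u⁆⊆H {f = f} {u} fu>0 x∈⁅u⁆ =
  subst (_∈ H f u) (sym (x∈⁅y⁆⇒x≡y u x∈⁅u⁆)) (∈H⁺ f u fu>0 (≤-trans (≤-reflexive (dist-self u)) z≤n))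

Separated : (Fin n → ℕ) → Set
Separated {n} f = ∀ (u v : Fin n) → 0 < f u → 0 < f v → u ≢ v → f v < dist u v

independent⇒separated : {f : Fin n → ℕ} → IsIndependent f → Separated f
independent⇒separated {f = f} (_ , one) u v fu>0 fv>0 u≢v with dist u v ≤? f v
... | no u≁v = ≰⇒> u≁v
... | yes u∼v = contradiction (one u fu>0) (>⇒≢ (subst (_< ∣ H f u ∣) (∣⁅x⁆∣≡1 u) (p⊂q⇒∣p∣<∣q∣ ⁅u⁆⊂H)))
  where
  ⁅u⁆⊂H : ⁅ u ⁆ ⊂ H f u
  ⁅u⁆⊂H = ⁅u⁆⊆H fu>0 , v , ∈H⁺ f u fv>0 u∼v , x≢y⇒x∉⁅y⁆ (≢-sym u≢v)

separated⇒independent : {f : Fin n → ℕ} → IsBroadcast f → Separated f → IsIndependent f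
separated⇒independent {f = f} broadcast sep = broadcast , λ u fu>0 →
  trans (cong ∣_∣ (H≡⁅u⁆ u fu>0)) (∣⁅x⁆∣≡1 u)
  where
  heard-only-self : ∀ u → 0 < f u → ∀ {x} → x ∈ H f u → x ≡ u
  heard-only-self u fu>0 {x} x∈H with x ≟ u | ∈H⁻ f u x∈H
  ... | yes x≡u | _ = x≡u
  ... | no x≢u | fx>0 , u∼x = contradiction u∼x (<⇒≱ (sep u x fu>0 fx>0 (≢-sym x≢u)))
  H≡⁅u⁆ : ∀ u → 0 < f u → H f u ≡ ⁅ u ⁆
  H≡⁅u⁆ u fu>0 = ⊆-antisym
    (λ x∈H → subst (_∈ ⁅ u ⁆) (sym (heard-only-self u fu>0 x∈H)) (x∈⁅x⁆ u))
    (⁅u⁆⊆H fu>0)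

raise : (Fin n → ℕ) → Fin n → Fin n → ℕ
raise f w v with v ≟ w
... | yes _ = suc (f v)
... | no _  = f v

raise-at : (f : Fin n → ℕ) (w : Fin n) → raise f w w ≡ suc (f w)
raise-at f w with w ≟ w
... | yes _   = refl
... | no w≢w = contradiction refl w≢w

f≤raise : (f : Fin n → ℕ) (w v : Fin n) → f v ≤ raise f w v
f≤raise f w v with v ≟ w
... | yes _ = n≤1+n (f v)
... | no _  = ≤-refl

Raisable : (Fin n → ℕ) → Fin n → Set
Raisable {n} f w = suc (f w) ≤ diam n × suc (f w) ≤ ecc w
  × (∀ v → 0 < f v → v ≢ w → f v < dist w v × suc (f w) < dist w v)

raise-independent : {f : Fin n → ℕ} {w : Fin n} → IsIndependent f → Raisable f w → IsIndependent (raise f w)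
raise-independent {f = f} {w} independent (≤diam , ≤ecc , far) =
  separated⇒independent broadcast separated
  where
  broadcast : IsBroadcast (raise f w)
  broadcast v with v ≟ w
  ... | yes refl = ≤diam , ≤ecc
  ... | no _     = proj₁ independent v
  separated : Separated (raise f w)
  separated u v fu>0 fv>0 u≢v with u ≟ w | v ≟ w
  ... | yes refl | yes refl = contradiction refl u≢v
  ... | yes refl | no v≢w   = proj₁ (far v fv>0 v≢w)
  ... | no u≢w   | yes refl = subst (suc (f w) <_) (dist-sym w u) (proj₂ (far u fu>0 u≢w))
  ... | no _     | no _     = independent⇒separated independent u v fu>0 fv>0 u≢v

maximal⇒¬raisable : {f : Fin n → ℕ} {w : Fin n} → IsMaximalIndependent f → ¬ Raisable f w
maximal⇒¬raisable {f = f} {w} (independent , maximal) raisable =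
  1+n≢n (trans (sym (raise-at f w))
    (maximal (raise f w) (raise-independent independent raisable) (f≤raise f w) w))

Undominated : (Fin n → ℕ) → Fin n → Set
Undominated f w = ∀ v → 0 < f v → f v < dist w v

undominated⇒silent : {f : Fin n → ℕ} {w : Fin n} → Undominated f w → f w ≡ 0
undominated⇒silent {f = f} {w} undominated =
  n≤0⇒n≡0 (≮⇒≥ λ fw>0 → n≮0 (subst (f w <_) (dist-self w) (undominated w fw>0)))

maximal⇒¬undominated : {f : Fin (2 + n) → ℕ} → IsMaximalIndependent f → ∀ w → ¬ Undominated f w
maximal⇒¬undominated {n} {f} maximal w undominated =
  maximal⇒¬raisable maximal (fits (s≤s z≤n) , fits (1≤ecc w) , far)
  where
  fits : ∀ {m} → 1 ≤ m → suc (f w) ≤ m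
  fits = subst (λ x → suc x ≤ _) (sym (undominated⇒silent undominated))
  far : ∀ v → 0 < f v → v ≢ w → f v < dist w v × suc (f w) < dist w v
  far v fv>0 _ = undominated v fv>0 , <-≤-trans (s≤s (fits fv>0)) (undominated v fv>0)

shielded : {f : Fin n → ℕ} {p v w : Fin n} → Separated f → 0 < f p → 0 < f v → p ≢ v →
           Between v p w → f v < dist w v
shielded {f = f} {p} {v} {w} separated fp>0 fv>0 p≢v between = begin-strict
  f v       <⟨ separated p v fp>0 fv>0 p≢v ⟩
  dist p v  ≡⟨ dist-sym p v ⟩
  dist v p  ≤⟨ between⇒dist≤ between ⟩
  dist v w  ≡⟨ dist-sym v w ⟩
  dist w v  ∎
  where open ≤-Reasoning

-- Otherwise e could raise its power.
dist-to-next≤ : {f : Fin n → ℕ} {e p : Fin n} → IsMaximalIndependent f → 0 < f e →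
                (∀ v → 0 < f v → v ≢ e → Between e p v) → dist e p ≤ suc (f e)
dist-to-next≤ {n} {f} {e} {p} maximal fe>0 beyond with dist e p ≤? suc (f e)
... | yes close = close
... | no far = contradiction (≤diam , ≤ecc , others-far) (maximal⇒¬raisable maximal)
  where
  gap : suc (f e) < dist e p
  gap = ≰⇒> far
  ≤ecc : suc (f e) ≤ ecc e
  ≤ecc = ≤-trans (<⇒≤ gap) (dist≤ecc e p)
  ≤diam : suc (f e) ≤ diam n
  ≤diam = ≤-trans ≤ecc (ecc≤diam e)
  others-far : ∀ v → 0 < f v → v ≢ e → f v < dist e v × suc (f e) < dist e v
  others-far v fv>0 v≢e = independent⇒separated (proj₁ maximal) e v fe>0 fv>0 (≢-sym v≢e)
                        , <-≤-trans gap (between⇒dist≤ (beyond v fv>0 v≢e))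

module Enumerated {n} {f : Fin (2 + n) → ℕ} (maximal : IsMaximalIndependent f)
  {m} (idx : Fin (suc (suc m)) → Fin (2 + n))
  (increasing : ∀ j j′ → j <ᶠ j′ → toℕ (idx j) < toℕ (idx j′))
  (support : ∀ v → (0 < f v) ⇔ (∃ λ j → idx j ≡ v)) where

  first second penultimate last : Fin (2 + n)
  first       = idx zero
  second      = idx (suc zero)
  penultimate = idx (inject₁ (fromℕ m))
  last        = idx (fromℕ (suc m))

  left right : Fin (suc m) → Fin (2 + n)
  left j  = idx (inject₁ j)
  right j = idx (suc j)

  separated : Separated f
  separated = independent⇒separated (proj₁ maximal)

  positive : ∀ j → 0 < f (idx j)
  positive j = Equivalence.from (support (idx j)) (j , refl)

  idx-monotone : ∀ {j j′} → toℕ j ≤ toℕ j′ → toℕ (idx j) ≤ toℕ (idx j′)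
  idx-monotone {j} {j′} j≤j′ with m≤n⇒m<n∨m≡n j≤j′
  ... | inj₁ j<j′ = <⇒≤ (increasing j j′ j<j′)
  ... | inj₂ j≡j′ = ≤-reflexive (cong (λ i → toℕ (idx i)) (toℕ-injective j≡j′))

  left<right : ∀ j → toℕ (left j) < toℕ (right j)
  left<right j = increasing (inject₁ j) (suc j) (≤̄⇒inject₁< ≤-refl)

  first-view : ∀ v → 0 < f v → v ≡ first ⊎ toℕ second ≤ toℕ v
  first-view v fv>0 with Equivalence.to (support v) fv>0
  ... | zero  , refl = inj₁ refl
  ... | suc j , refl = inj₂ (idx-monotone {suc zero} {suc j} (s≤s z≤n))

  last-view : ∀ v → 0 < f v → v ≡ last ⊎ toℕ v ≤ toℕ penultimate
  last-view v fv>0 with Equivalence.to (support v) fv>0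
  ... | j , refl with m≤n⇒m<n∨m≡n (toℕ≤pred[n] j)
  ...   | inj₂ j≡1+m = inj₁ (cong idx (toℕ-injective (trans j≡1+m (sym (toℕ-fromℕ (suc m))))))
  ...   | inj₁ j<1+m = inj₂ (idx-monotone (subst (toℕ j ≤_)
                               (sym (trans (toℕ-inject₁ (fromℕ m)) (toℕ-fromℕ m))) (≤-pred j<1+m)))

  data GapView (j : Fin (suc m)) (v : Fin (2 + n)) : Set where
    left-of  : toℕ v < toℕ (left j) → GapView j v
    at-left  : v ≡ left j → GapView j v
    at-right : v ≡ right j → GapView j v
    right-of : toℕ (right j) < toℕ v → GapView j v

  gap-view : ∀ j v → 0 < f v → GapView j v
  gap-view j v fv>0 with Equivalence.to (support v) fv>0
  ... | j′ , refl with <-cmp (toℕ j′) (toℕ j)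
  ...   | tri< j′<j _ _ = left-of (increasing j′ (inject₁ j) (subst (toℕ j′ <_) (sym (toℕ-inject₁ j)) j′<j))
  ...   | tri≈ _ j′≡j _ = at-left (cong idx (toℕ-injective (trans j′≡j (sym (toℕ-inject₁ j)))))
  ...   | tri> _ _ j<j′ with m≤n⇒m<n∨m≡n j<j′
  ...     | inj₁ 1+j<j′ = right-of (increasing (suc j) j′ 1+j<j′)
  ...     | inj₂ 1+j≡j′ = at-right (cong idx (toℕ-injective (sym 1+j≡j′)))

  before-first-undominated : ∀ {w} → toℕ w ≤ toℕ first → f first < dist w first → Undominated f w
  before-first-undominated {w} w≤first reach v fv>0 with first-view v fv>0
  ... | inj₁ refl = reach
  ... | inj₂ second≤v = shielded separated (positive zero) fv>0 (toℕ<⇒≢ first<v)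
                          (inj₂ (w≤first , <⇒≤ first<v))
    where first<v = <-≤-trans (left<right zero) second≤v

  after-last-undominated : ∀ {w} → toℕ last ≤ toℕ w → f last < dist w last → Undominated f w
  after-last-undominated {w} last≤w reach v fv>0 with last-view v fv>0
  ... | inj₁ refl = reach
  ... | inj₂ v≤penultimate = shielded separated (positive _) fv>0 (≢-sym (toℕ<⇒≢ v<last))
                               (inj₁ (<⇒≤ v<last , last≤w))
    where v<last = ≤-<-trans v≤penultimate (left<right (fromℕ m))

  inside-gap-undominated : ∀ j {w} → toℕ (left j) ≤ toℕ w → toℕ w ≤ toℕ (right j) →
                           f (left j) < dist w (left j) → f (right j) < dist w (right j) → Undominated f w
  inside-gap-undominated j left≤w w≤right reach-left reach-right v fv>0 with gap-view j v fv>0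
  ... | at-left refl  = reach-left
  ... | at-right refl = reach-right
  ... | left-of v<left = shielded separated (positive _) fv>0 (≢-sym (toℕ<⇒≢ v<left))
                           (inj₁ (<⇒≤ v<left , left≤w))
  ... | right-of right<v = shielded separated (positive _) fv>0 (toℕ<⇒≢ right<v)
                             (inj₂ (w≤right , <⇒≤ right<v))

  first-reaches-start : dist zero first ≤ f first
  first-reaches-start with dist zero first ≤? f first
  ... | yes reaches = reaches
  ... | no short = contradiction (before-first-undominated z≤n (≰⇒> short)) (maximal⇒¬undominated maximal zero)

  last-reaches-end : dist last (fromℕ (suc n)) ≤ f last
  last-reaches-end with dist last (fromℕ (suc n)) ≤? f last
  ... | yes reaches = reaches
  ... | no short = contradiction (after-last-undominated last≤end (subst (f last <_) (dist-sym last _) (≰⇒> short)))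
                                 (maximal⇒¬undominated maximal (fromℕ (suc n)))
    where last≤end = subst (toℕ last ≤_) (sym (toℕ-fromℕ (suc n))) (toℕ≤pred[n] last)

  gap-lower : ∀ j → (f (left j) ⊔ f (right j)) + 1 ≤ dist (left j) (right j)
  gap-lower j = subst (_≤ dist (left j) (right j)) (+-comm 1 _) (⊔-lub left-unheard right-unheard)
    where
    left-unheard : f (left j) < dist (left j) (right j)
    left-unheard = subst (f (left j) <_) (dist-sym (right j) (left j))
      (separated (right j) (left j) (positive _) (positive _) (≢-sym (toℕ<⇒≢ (left<right j))))
    right-unheard : f (right j) < dist (left j) (right j)
    right-unheard = separated (left j) (right j) (positive _) (positive _) (toℕ<⇒≢ (left<right j))

  -- Otherwise the vertex at distance f (left j) + 1 to the right of left j is undominated.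
  gap-upper : ∀ j → dist (left j) (right j) ≤ f (left j) + f (right j) + 1
  gap-upper j with dist (left j) (right j) ≤? f (left j) + f (right j) + 1
  ... | yes narrow = narrow
  ... | no wide = contradiction (inside-gap-undominated j left≤w w≤right reach-left reach-right)
                                (maximal⇒¬undominated maximal w)
    where
    L = toℕ (left j)
    R = toℕ (right j)
    room : L + suc (f (left j)) + suc (f (right j)) ≤ R
    room = ∣m-n∣>a+b+1⇒m+[1+a]+[1+b]≤n _ _ (<⇒≤ (left<right j)) (≰⇒> wide)
    w : Fin (2 + n)
    w = fromℕ< (≤-<-trans (m+n≤o⇒m≤o _ room) (toℕ<n (right j)))
    toℕ-w : toℕ w ≡ L + suc (f (left j))
    toℕ-w = toℕ-fromℕ< _
    left≤w : L ≤ toℕ w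
    left≤w = subst (L ≤_) (sym toℕ-w) (m≤m+n L _)
    w≤right : toℕ w ≤ R
    w≤right = subst (_≤ R) (sym toℕ-w) (m+n≤o⇒m≤o _ room)
    reach-left : f (left j) < dist w (left j)
    reach-left = m+n≤o⇒n≤∣o-m∣ L (≤-reflexive (sym toℕ-w))
    reach-right : f (right j) < dist w (right j)
    reach-right = subst (f (right j) <_) (∣-∣-comm R (toℕ w))
      (m+n≤o⇒n≤∣o-m∣ (toℕ w) (subst (λ x → x + suc (f (right j)) ≤ R) (sym toℕ-w) room))

  first-gap : dist first second ≡ f first + 1
  first-gap = ≤-antisym (subst (dist first second ≤_) (+-comm 1 (f first)) (dist-to-next≤ maximal (positive zero) beyond))
                        (≤-trans (+-monoˡ-≤ 1 (m≤m⊔n _ _)) (gap-lower zero))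
    where
    beyond : ∀ v → 0 < f v → v ≢ first → Between first second v
    beyond v fv>0 v≢first with first-view v fv>0
    ... | inj₁ v≡first = contradiction v≡first v≢first
    ... | inj₂ second≤v = inj₁ (<⇒≤ (left<right zero) , second≤v)

  last-gap : dist penultimate last ≡ f last + 1
  last-gap = ≤-antisym (subst (_≤ f last + 1) (dist-sym last penultimate)
                              (subst (dist last penultimate ≤_) (+-comm 1 (f last)) (dist-to-next≤ maximal (positive _) beyond)))
                       (≤-trans (+-monoˡ-≤ 1 (m≤n⊔m _ _)) (gap-lower (fromℕ m)))
    where
    beyond : ∀ v → 0 < f v → v ≢ last → Between last penultimate v
    beyond v fv>0 v≢last with last-view v fv>0
    ... | inj₁ v≡last = contradiction v≡last v≢last
    ... | inj₂ v≤penultimate = inj₂ (v≤penultimate , <⇒≤ (left<right (fromℕ m)))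

  first≥second : f first ≥ f second
  first≥second = ≤-pred (subst (f second <_) (trans first-gap (+-comm (f first) 1))
    (separated first second (positive _) (positive _) (toℕ<⇒≢ (left<right zero))))

  last≥penultimate : f last ≥ f penultimate
  last≥penultimate = ≤-pred (subst (f penultimate <_) (trans (trans (dist-sym last penultimate) last-gap) (+-comm (f last) 1))
    (separated last penultimate (positive _) (positive _) (≢-sym (toℕ<⇒≢ (left<right (fromℕ m))))))

lemma3p6 : (k : ℕ) → let n = 3 + k in (f : Fin n → ℕ) → IsMinMaximalIndependent f →
  (m : ℕ) → (idx : Fin (suc (suc m)) → Fin n) →
  (∀ j j′ → j <ᶠ j′ → toℕ (idx j) < toℕ (idx j′)) →
  (∀ v → (0 < f v) ⇔ (∃ λ j → idx j ≡ v)) →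
  let i₁ = idx zero
      i₂ = idx (suc zero)
      iₜ = idx (fromℕ (suc m))
      iₜ₋₁ = idx (inject₁ (fromℕ m))
  in ((f i₁ ≥ f i₂) × (f iₜ ≥ f iₜ₋₁))
   × ((dist zero i₁ ≤ f i₁) × (dist iₜ (fromℕ (2 + k)) ≤ f iₜ))
   × (∀ (j : Fin (suc m)) →
        ((f (idx (inject₁ j)) ⊔ f (idx (suc j))) + 1 ≤ dist (idx (inject₁ j)) (idx (suc j)))
        × (dist (idx (inject₁ j)) (idx (suc j)) ≤ f (idx (inject₁ j)) + f (idx (suc j)) + 1))
   × ((dist i₁ i₂ ≡ f i₁ + 1) × (dist iₜ₋₁ iₜ ≡ f iₜ + 1))
lemma3p6 k f (maximal , _) m idx increasing support =
    (first≥second , last≥penultimate)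
  , (first-reaches-start , last-reaches-end)
  , (λ j → gap-lower j , gap-upper j)
  , (first-gap , last-gap)
  where open Enumerated maximal idx increasing support
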